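{- Let $r,s,n$ be positive integers with $s<r<n$, and define the $n\times n$ matrix $X=X^{(r,s,n)}=[x_{ij}]$ by \[ x_{ij}=\begin{cases} 1/r & (i\le r,\ j\le s),\\ (r-s)/(r(n-s)) & (i\le r,\ s<j\le n),\\ 0 & (r<i\le n,\ j\le s),\\ 1/(n-s) & (r<i\le n,\ s<j\le n).\end{cases} \] Then $X$ is an RCDS doubly stochastic matrix, i.e. $X$ is doubly stochastic and all diagonals of $X$ avoiding the zero entries of $X$ have the same diagonal sum.
   Context: A square nonnegative matrix is doubly stochastic if all row and column sums equal $1$. For a permutation $\sigma$ of $\{1,\ldots,n\}$, the diagonal corresponding to $\sigma$ is the set of positions $(i,\sigma(i))$, with diagonal sum $\sum_i x_{i,\sigma(i)}$; it avoids the zero entries if $x_{i,\sigma(i)}\ne 0$ for all $i$. -}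

module Defs where

open import Data.Nat as ℕ using (ℕ; zero; suc; _∸_; _≤_; _<_; NonZero; >-nonZero; _≤ᵇ_)
open import Data.Nat.Properties using (m<n⇒0<n∸m; m*n≢0)
open import Data.Integer using (+_)
open import Data.Fin using (Fin; toℕ)
open import Data.Fin.Permutation using (Permutation′; _⟨$⟩ʳ_)
open import Data.Rational using (ℚ; 0ℚ; 1ℚ; _+_; _/_)
open import Data.Bool using (if_then_else_)
open import Relation.Binary.PropositionalEquality using (_≡_; _≢_)

Σℚ : ∀ {n} → (Fin n → ℚ) → ℚ
Σℚ {zero}  f = 0ℚ
Σℚ {suc n} f = f Data.Fin.zero + Σℚ (λ i → f (Data.Fin.suc i))

Matrix : ℕ → Set
Matrix n = Fin n → Fin n → ℚ

open import Data.Rational using () renaming (_≤_ to _≤ℚ_)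

DoublyStochastic : ∀ {n} → Matrix n → Set
DoublyStochastic {n} X =
  (∀ i j → 0ℚ ≤ℚ X i j)
  Data.Product.× (∀ i → Σℚ (λ j → X i j) ≡ 1ℚ)
  Data.Product.× (∀ j → Σℚ (λ i → X i j) ≡ 1ℚ)
  where import Data.Product

diagSum : ∀ {n} → Matrix n → Permutation′ n → ℚ
diagSum X σ = Σℚ (λ i → X i (σ ⟨$⟩ʳ i))

AvoidsZeros : ∀ {n} → Matrix n → Permutation′ n → Set
AvoidsZeros X σ = ∀ i → X i (σ ⟨$⟩ʳ i) ≢ 0ℚ

RCDS : ∀ {n} → Matrix n → Set
RCDS X = DoublyStochastic X
  Data.Product.× (∀ σ τ → AvoidsZeros X σ → AvoidsZeros X τ → diagSum X σ ≡ diagSum X τ)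
  where import Data.Product

-- the matrix X^(r,s,n); indices are 0-based, so "i ≤ r" (1-based) is "toℕ i < r"
Xmat : (r s n : ℕ) → 0 < r → s < n → Matrix n
Xmat r s n 0<r s<n i j =
  if suc (toℕ i) ≤ᵇ r
  then (if suc (toℕ j) ≤ᵇ s then (+ 1) / r
        else (+ (r ∸ s)) / (r ℕ.* (n ∸ s)))
  else (if suc (toℕ j) ≤ᵇ s then 0ℚ
        else (+ 1) / (n ∸ s))
  where
  instance
    nzr : NonZero r
    nzr = >-nonZero 0<r
    nzns : NonZero (n ∸ s)
    nzns = >-nonZero (m<n⇒0<n∸m s<n)
    nzp : NonZero (r ℕ.* (n ∸ s))
    nzp = m*n≢0 r (n ∸ s)

-- X is the block matrix [[a c] [0 d]] with an r × s upper-left block, where a = 1/r,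
-- c = (r−s)/(r(n−s)), d = 1/(n−s). Since the zero block imposes no condition, there are
-- row potentials u (c − d on the first r rows, 0 below) and column potentials v (a + d − c
-- on the first s columns, d to the right) with x_ij = u_i + v_j at every nonzero entry;
-- hence every diagonal avoiding the zeros has sum Σu + Σv. The line sums reduce to
-- s/r + (r−s)/r = 1 and (r−s)/(n−s) + (n−r)/(n−s) = 1.

module Submission where

open import Defs
open import Data.Nat using (ℕ; _<_)
open import Data.Nat.Properties using (<-trans)

open import Data.Nat as ℕ using (zero; suc; _∸_; _≤_; z≤n; s≤s; NonZero; _≤ᵇ_)
import Data.Nat.Properties as ℕ
open import Data.Nat.Tactic.RingSolver using () renaming (solve to ℕ-solve)
open import Data.List using ([]; _∷_)
open import Data.Integer as ℤ using (+_)
import Data.Integer.Properties as ℤ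
open import Data.Rational using (ℚ; 0ℚ; 1ℚ; _+_; _-_; _/_; toℚᵘ; fromℚᵘ) renaming (_≤_ to _≤ℚ_)
import Data.Rational.Properties as ℚ
import Data.Rational.Unnormalised.Properties as ℚᵘ
open import Data.Rational.Unnormalised as ℚᵘ using (mkℚᵘ; *≡*)
open import Data.Rational.Solver using (module +-*-Solver)
open import Data.Fin using (Fin; toℕ) renaming (zero to fzero; suc to fsuc)
open import Data.Fin.Permutation using (Permutation′; _⟨$⟩ʳ_)
open import Data.Bool using (Bool; true; false; if_then_else_)
open import Data.Product using (_,_)
open import Relation.Binary.PropositionalEquality
open import Relation.Nullary using (contradiction)
open import Algebra.Properties.CommutativeMonoid.Sum ℚ.+-0-commutativeMonoid
  using (sum; sum-permute; ∑-distrib-+; sum-replicate; sum-replicate-zero; sum-cong-≗)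
open import Algebra.Properties.Monoid.Mult ℚ.+-0-monoid using (_×_)

/-cross : ∀ a b D E .{{_ : NonZero D}} .{{_ : NonZero E}} →
            a ℕ.* E ≡ b ℕ.* D → + a / D ≡ + b / E
/-cross a b (suc d) (suc e) aE≡bD = ℚ.fromℚᵘ-cong {mkℚᵘ (+ a) d} {mkℚᵘ (+ b) e} (*≡* (begin
  + a ℤ.* + suc e   ≡⟨ ℤ.pos-* a (suc e) ⟨
  + (a ℕ.* suc e)   ≡⟨ cong +_ aE≡bD ⟩
  + (b ℕ.* suc d)   ≡⟨ ℤ.pos-* b (suc d) ⟩
  + b ℤ.* + suc d   ∎))
  where open ≡-Reasoning

/-≡1 : ∀ a D .{{_ : NonZero D}} → a ≡ D → + a / D ≡ 1ℚ
/-≡1 a D a≡D = /-cross a 1 D 1 (trans (ℕ.*-identityʳ a) (trans a≡D (sym (ℕ.*-identityˡ D))))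

fromℚᵘ-homo-+ : ∀ p q → fromℚᵘ (p ℚᵘ.+ q) ≡ fromℚᵘ p + fromℚᵘ q
fromℚᵘ-homo-+ p q = ℚ.toℚᵘ-injective (begin
  toℚᵘ (fromℚᵘ (p ℚᵘ.+ q))                    ≈⟨ ℚ.toℚᵘ-fromℚᵘ (p ℚᵘ.+ q) ⟩
  p ℚᵘ.+ q                                    ≈⟨ ℚᵘ.+-cong (ℚ.toℚᵘ-fromℚᵘ p) (ℚ.toℚᵘ-fromℚᵘ q) ⟨
  toℚᵘ (fromℚᵘ p) ℚᵘ.+ toℚᵘ (fromℚᵘ q)        ≈⟨ ℚ.toℚᵘ-homo-+ (fromℚᵘ p) (fromℚᵘ q) ⟨
  toℚᵘ (fromℚᵘ p + fromℚᵘ q)                  ∎)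
  where open ℚᵘ.≃-Reasoning

/-+-/ : ∀ a b D E .{{_ : NonZero D}} .{{_ : NonZero E}} →
        + a / D + + b / E ≡ _/_ (+ (a ℕ.* E ℕ.+ b ℕ.* D)) (D ℕ.* E) {{ℕ.m*n≢0 D E}}
/-+-/ a b (suc d) (suc e) = begin
  + a / suc d + + b / suc e
    ≡⟨ fromℚᵘ-homo-+ (mkℚᵘ (+ a) d) (mkℚᵘ (+ b) e) ⟨
  fromℚᵘ (mkℚᵘ (+ a) d ℚᵘ.+ mkℚᵘ (+ b) e)
    ≡⟨ cong (λ z → fromℚᵘ (z ℚᵘ./ (suc d ℕ.* suc e))) numerator ⟩
  + (a ℕ.* suc e ℕ.+ b ℕ.* suc d) / (suc d ℕ.* suc e)
    ∎
  where
  open ≡-Reasoning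
  numerator : + a ℤ.* + suc e ℤ.+ + b ℤ.* + suc d ≡ + (a ℕ.* suc e ℕ.+ b ℕ.* suc d)
  numerator = begin
    + a ℤ.* + suc e ℤ.+ + b ℤ.* + suc d       ≡⟨ cong₂ ℤ._+_ (ℤ.pos-* a (suc e)) (ℤ.pos-* b (suc d)) ⟨
    + (a ℕ.* suc e) ℤ.+ + (b ℕ.* suc d)       ≡⟨ ℤ.pos-+ (a ℕ.* suc e) (b ℕ.* suc d) ⟨
    + (a ℕ.* suc e ℕ.+ b ℕ.* suc d)           ∎

×-/ : ∀ k a D .{{_ : NonZero D}} → k × (+ a / D) ≡ + (k ℕ.* a) / D
×-/ zero    a D = sym (ℚ.0/n≡0 D)
×-/ (suc k) a D = begin
  + a / D + k × (+ a / D)               ≡⟨ cong (λ x → + a / D + x) (×-/ k a D) ⟩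
  + a / D + + (k ℕ.* a) / D             ≡⟨ /-+-/ a (k ℕ.* a) D D ⟩
  _/_ (+ (a ℕ.* D ℕ.+ k ℕ.* a ℕ.* D)) (D ℕ.* D) {{ℕ.m*n≢0 D D}}
                                        ≡⟨ /-cross (a ℕ.* D ℕ.+ k ℕ.* a ℕ.* D) (suc k ℕ.* a) (D ℕ.* D) D
                                             {{ℕ.m*n≢0 D D}} (ℕ-solve (a ∷ k ∷ D ∷ [])) ⟩
  + (suc k ℕ.* a) / D                   ∎
  where open ≡-Reasoning

×-zero : ∀ k → k × 0ℚ ≡ 0ℚ
×-zero k = trans (sym (sum-replicate k)) (sum-replicate-zero k)

×-/≡1 : ∀ k a D .{{_ : NonZero D}} → k ℕ.* a ≡ D → k × (+ a / D) ≡ 1ℚ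
×-/≡1 k a D ka≡D = trans (×-/ k a D) (/-≡1 (k ℕ.* a) D ka≡D)

×-/+×-/≡1 : ∀ k a D l b E .{{_ : NonZero D}} .{{_ : NonZero E}} →
            k ℕ.* a ℕ.* E ℕ.+ l ℕ.* b ℕ.* D ≡ D ℕ.* E →
            k × (+ a / D) + l × (+ b / E) ≡ 1ℚ
×-/+×-/≡1 k a D l b E numerator≡denominator = begin
  k × (+ a / D) + l × (+ b / E)                     ≡⟨ cong₂ _+_ (×-/ k a D) (×-/ l b E) ⟩
  + (k ℕ.* a) / D + + (l ℕ.* b) / E                 ≡⟨ /-+-/ (k ℕ.* a) (l ℕ.* b) D E ⟩
  _/_ (+ (k ℕ.* a ℕ.* E ℕ.+ l ℕ.* b ℕ.* D)) (D ℕ.* E) {{ℕ.m*n≢0 D E}}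
                                                    ≡⟨ /-≡1 _ (D ℕ.* E) {{ℕ.m*n≢0 D E}} numerator≡denominator ⟩
  1ℚ                                                ∎
  where open ≡-Reasoning

0≤/ : ∀ a D .{{_ : NonZero D}} → 0ℚ ≤ℚ + a / D
0≤/ a D = ℚ.nonNegative⁻¹ (+ a / D) {{ℚ.normalize-nonNeg a D}}

Σℚ≡sum : ∀ {n} (f : Fin n → ℚ) → Σℚ f ≡ sum f
Σℚ≡sum {zero}  f = refl
Σℚ≡sum {suc n} f = cong (_+_ (f fzero)) (Σℚ≡sum (λ i → f (fsuc i)))

Σℚ-cong : ∀ {n} {f g : Fin n → ℚ} → (∀ i → f i ≡ g i) → Σℚ f ≡ Σℚ g
Σℚ-cong {f = f} {g} f≗g = trans (Σℚ≡sum f) (trans (sum-cong-≗ f≗g) (sym (Σℚ≡sum g)))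

Σℚ-+ : ∀ {n} (f g : Fin n → ℚ) → Σℚ (λ i → f i + g i) ≡ Σℚ f + Σℚ g
Σℚ-+ f g = trans (Σℚ≡sum (λ i → f i + g i))
  (trans (∑-distrib-+ f g) (sym (cong₂ _+_ (Σℚ≡sum f) (Σℚ≡sum g))))

Σℚ-permute : ∀ {n} (f : Fin n → ℚ) (σ : Permutation′ n) → Σℚ (λ i → f (σ ⟨$⟩ʳ i)) ≡ Σℚ f
Σℚ-permute f σ = trans (Σℚ≡sum (λ i → f (σ ⟨$⟩ʳ i)))
  (trans (sym (sum-permute f σ)) (sym (Σℚ≡sum f)))

Σℚ-const : ∀ n x → Σℚ {n} (λ _ → x) ≡ n × x
Σℚ-const n x = trans (Σℚ≡sum {n} (λ _ → x)) (sum-replicate n)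

inFirst : ∀ {n} → ℕ → Fin n → Bool
inFirst t i = suc (toℕ i) ≤ᵇ t

Σℚ-inFirst : ∀ {n} t x y → t ≤ n →
             Σℚ {n} (λ i → if inFirst t i then x else y) ≡ t × x + (n ∸ t) × y
Σℚ-inFirst {n}     zero    x y z≤n       = trans (Σℚ-const n y) (sym (ℚ.+-identityˡ (n × y)))
Σℚ-inFirst {suc n} (suc t) x y (s≤s t≤n) = trans (cong (_+_ x) (Σℚ-inFirst t x y t≤n))
                                                  (sym (ℚ.+-assoc x (t × x) ((n ∸ t) × y)))

SplitsOnSupport : ∀ {n} → Matrix n → (Fin n → ℚ) → (Fin n → ℚ) → Set
SplitsOnSupport X u v = ∀ i j → X i j ≢ 0ℚ → X i j ≡ u i + v j

diagSum-splitsOnSupport : ∀ {n} {X : Matrix n} u v → SplitsOnSupport X u v →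
                          ∀ σ → AvoidsZeros X σ → diagSum X σ ≡ Σℚ u + Σℚ v
diagSum-splitsOnSupport {X = X} u v split σ avoids = begin
  Σℚ (λ i → X i (σ ⟨$⟩ʳ i))          ≡⟨ Σℚ-cong (λ i → split i (σ ⟨$⟩ʳ i) (avoids i)) ⟩
  Σℚ (λ i → u i + v (σ ⟨$⟩ʳ i))      ≡⟨ Σℚ-+ u (λ i → v (σ ⟨$⟩ʳ i)) ⟩
  Σℚ u + Σℚ (λ i → v (σ ⟨$⟩ʳ i))     ≡⟨ cong (_+_ (Σℚ u)) (Σℚ-permute v σ) ⟩
  Σℚ u + Σℚ v                        ∎
  where open ≡-Reasoning

splitsOnSupport⇒RCDS : ∀ {n} {X : Matrix n} u v →
                       DoublyStochastic X → SplitsOnSupport X u v → RCDS X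
splitsOnSupport⇒RCDS u v doublyStochastic split = doublyStochastic , λ σ τ σ-avoids τ-avoids →
  trans (diagSum-splitsOnSupport u v split σ σ-avoids)
        (sym (diagSum-splitsOnSupport u v split τ τ-avoids))

block : ℚ → ℚ → ℚ → Bool → Bool → ℚ
block a c d top left = if top then (if left then a else c) else (if left then 0ℚ else d)

blockMatrix : ∀ {n} → ℕ → ℕ → ℚ → ℚ → ℚ → Matrix n
blockMatrix t k a c d i j = block a c d (inFirst t i) (inFirst k j)

rowPotential : ℚ → ℚ → ℚ → Bool → ℚ
rowPotential a c d true  = c - d
rowPotential a c d false = 0ℚ

columnPotential : ℚ → ℚ → ℚ → Bool → ℚ
columnPotential a c d true  = (a + d) - c
columnPotential a c d false = d

block-splitsOnSupport : ∀ a c d top left → block a c d top left ≢ 0ℚ →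
                        block a c d top left ≡ rowPotential a c d top + columnPotential a c d left
block-splitsOnSupport a c d true  true  _   = a≡[c-d]+[[a+d]-c] a c d
  where
  open +-*-Solver
  a≡[c-d]+[[a+d]-c] : ∀ a c d → a ≡ (c - d) + ((a + d) - c)
  a≡[c-d]+[[a+d]-c] = solve 3 (λ a c d → a := (c :- d) :+ ((a :+ d) :- c)) refl
block-splitsOnSupport a c d true  false _   = c≡[c-d]+d c d
  where
  open +-*-Solver
  c≡[c-d]+d : ∀ c d → c ≡ (c - d) + d
  c≡[c-d]+d = solve 2 (λ c d → c := (c :- d) :+ d) refl
block-splitsOnSupport a c d false true  0≢0 = contradiction refl 0≢0
block-splitsOnSupport a c d false false _   = sym (ℚ.+-identityˡ d)

blockMatrix-RCDS : ∀ {n} t k a c d → t ≤ n → k ≤ n →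
                   0ℚ ≤ℚ a → 0ℚ ≤ℚ c → 0ℚ ≤ℚ d →
                   k × a + (n ∸ k) × c ≡ 1ℚ → (n ∸ k) × d ≡ 1ℚ →
                   t × a ≡ 1ℚ → t × c + (n ∸ t) × d ≡ 1ℚ →
                   RCDS {n} (blockMatrix t k a c d)
blockMatrix-RCDS {n} t k a c d t≤n k≤n 0≤a 0≤c 0≤d topRow bottomRow leftColumn rightColumn =
  splitsOnSupport⇒RCDS
    (λ i → rowPotential a c d (inFirst t i)) (λ j → columnPotential a c d (inFirst k j))
    ( (λ i j → nonNegative (inFirst t i) (inFirst k j))
    , (λ i → rowSum (inFirst t i))
    , (λ j → columnSum (inFirst k j)))
    (λ i j → block-splitsOnSupport a c d (inFirst t i) (inFirst k j))
  where
  open ≡-Reasoning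
  nonNegative : ∀ top left → 0ℚ ≤ℚ block a c d top left
  nonNegative true  true  = 0≤a
  nonNegative true  false = 0≤c
  nonNegative false true  = ℚ.≤-refl
  nonNegative false false = 0≤d

  rowSum : ∀ top → Σℚ {n} (λ j → block a c d top (inFirst k j)) ≡ 1ℚ
  rowSum true  = trans (Σℚ-inFirst k a c k≤n) topRow
  rowSum false = begin
    Σℚ {n} (λ j → if inFirst k j then 0ℚ else d) ≡⟨ Σℚ-inFirst k 0ℚ d k≤n ⟩
    k × 0ℚ + (n ∸ k) × d                       ≡⟨ cong (_+ (n ∸ k) × d) (×-zero k) ⟩
    0ℚ + (n ∸ k) × d                           ≡⟨ ℚ.+-identityˡ ((n ∸ k) × d) ⟩
    (n ∸ k) × d                                ≡⟨ bottomRow ⟩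
    1ℚ                                         ∎

  columnSum : ∀ left → Σℚ {n} (λ i → block a c d (inFirst t i) left) ≡ 1ℚ
  columnSum true  = begin
    Σℚ {n} (λ i → if inFirst t i then a else 0ℚ) ≡⟨ Σℚ-inFirst t a 0ℚ t≤n ⟩
    t × a + (n ∸ t) × 0ℚ                       ≡⟨ cong (_+_ (t × a)) (×-zero (n ∸ t)) ⟩
    t × a + 0ℚ                                 ≡⟨ ℚ.+-identityʳ (t × a) ⟩
    t × a                                      ≡⟨ leftColumn ⟩
    1ℚ                                         ∎
  columnSum false = trans (Σℚ-inFirst t c d t≤n) rightColumn

[n∸m]+[o∸n]≡o∸m : ∀ {m n o} → m ≤ n → n ≤ o → (n ∸ m) ℕ.+ (o ∸ n) ≡ o ∸ m
[n∸m]+[o∸n]≡o∸m {m} {n} {o} m≤n n≤o = begin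
  (n ∸ m) ℕ.+ (o ∸ n)   ≡⟨ ℕ.+-∸-comm (o ∸ n) m≤n ⟨
  (n ℕ.+ (o ∸ n)) ∸ m   ≡⟨ cong (_∸ m) (ℕ.m+[n∸m]≡n n≤o) ⟩
  o ∸ m                 ∎
  where open ≡-Reasoning

topRow-identity : ∀ s a b {r} → s ℕ.+ a ≡ r →
                  s ℕ.* 1 ℕ.* (r ℕ.* b) ℕ.+ b ℕ.* a ℕ.* r ≡ r ℕ.* (r ℕ.* b)
topRow-identity s a b refl = ℕ-solve (s ∷ a ∷ b ∷ [])

rightColumn-identity : ∀ r a c {b} → a ℕ.+ c ≡ b →
                       r ℕ.* a ℕ.* b ℕ.+ c ℕ.* 1 ℕ.* (r ℕ.* b) ≡ r ℕ.* b ℕ.* b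
rightColumn-identity r a c refl = ℕ-solve (r ∷ a ∷ c ∷ [])

proposition5p2 : (r s n : ℕ) → (0<s : 0 < s) → (s<r : s < r) → (r<n : r < n) →
    RCDS (Xmat r s n (<-trans 0<s s<r) (<-trans s<r r<n))
proposition5p2 r s n 0<s s<r r<n =
  blockMatrix-RCDS r s (+ 1 / r) (+ (r ∸ s) / (r ℕ.* (n ∸ s))) (+ 1 / (n ∸ s)) r≤n s≤n
    (0≤/ 1 r) (0≤/ (r ∸ s) (r ℕ.* (n ∸ s))) (0≤/ 1 (n ∸ s))
    (×-/+×-/≡1 s 1 r (n ∸ s) (r ∸ s) (r ℕ.* (n ∸ s))
      (topRow-identity s (r ∸ s) (n ∸ s) (ℕ.m+[n∸m]≡n s≤r)))
    (×-/≡1 (n ∸ s) 1 (n ∸ s) (ℕ.*-identityʳ (n ∸ s)))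
    (×-/≡1 r 1 r (ℕ.*-identityʳ r))
    (×-/+×-/≡1 r (r ∸ s) (r ℕ.* (n ∸ s)) (n ∸ r) 1 (n ∸ s)
      (rightColumn-identity r (r ∸ s) (n ∸ r) ([n∸m]+[o∸n]≡o∸m s≤r r≤n)))
  where
  s≤r : s ≤ r
  s≤r = ℕ.<⇒≤ s<r
  r≤n : r ≤ n
  r≤n = ℕ.<⇒≤ r<n
  s≤n : s ≤ n
  s≤n = ℕ.≤-trans s≤r r≤n
  instance
    r≢0 : NonZero r
    r≢0 = ℕ.>-nonZero (<-trans 0<s s<r)
    n∸s≢0 : NonZero (n ∸ s)
    n∸s≢0 = ℕ.>-nonZero (ℕ.m<n⇒0<n∸m (<-trans s<r r<n))
    r*[n∸s]≢0 : NonZero (r ℕ.* (n ∸ s))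
    r*[n∸s]≢0 = ℕ.m*n≢0 r (n ∸ s)
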